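{- Let $k \ge 3$ be an odd integer and let $D$ be a $k$-quasi-transitive digraph with a unique initial strong component $C$. Then one of the following holds: (1) every vertex of $C$ is a $(k+1)$-king of $D$; (2) there are vertices $u_1, u_2, u_3 \in V(C)$ such that $u_1$ is a $(k+1)$-king of $D$, $u_2$ is a $(k+2)$-king of $D$, $(u_2,u_1) \in A(D)$, $d(u_2,u_3) = k+2$, and $u_3$ is a $4$-king of $D$; moreover, every vertex at distance $k+2$ from $u_2$ is a $4$-king of $D$.
   Context: All digraphs are finite, without loops and without multiple arcs in the same direction; paths are directed. For $u,v \in V(D)$, $d(u,v)$ is the length of a shortest directed $uv$-path ($\infty$ if none, $d(v,v)=0$). A vertex $v$ is an $r$-king of $D$ if $d(v,u) \le r$ for every $u \in V(D)$. $D$ is $k$-quasi-transitive if for every directed path $(v_0, \dots, v_k)$ of length $k$, $(v_0,v_k) \in A(D)$ or $(v_k,v_0) \in A(D)$. An initial strong component is a strong component with no arc entering it from outside. -}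

module Defs where

open import Data.Nat using (ℕ; zero; suc; _+_; _*_; _≤_; _<_)
open import Data.Fin using (Fin; zero; suc; fromℕ; inject₁)
open import Data.Bool using (Bool; true; false)
open import Data.Product using (Σ; ∃; _×_; _,_)
open import Data.Sum using (_⊎_)
open import Relation.Binary.PropositionalEquality using (_≡_)
open import Relation.Nullary using (¬_)
open import Function.Definitions using (Injective)

record Digraph : Set where
  field
    n        : ℕ
    arc      : Fin n → Fin n → Bool
    loopless : ∀ v → arc v v ≡ false

open Digraph public

V : Digraph → Set
V D = Fin (n D)

Arc : (D : Digraph) → V D → V D → Set
Arc D u v = arc D u v ≡ true

record Path (D : Digraph) (u v : V D) (m : ℕ) : Set where
  field
    vert     : Fin (suc m) → V D
    distinct : Injective _≡_ _≡_ vert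
    start    : vert zero ≡ u
    end      : vert (fromℕ m) ≡ v
    arcs     : ∀ (i : Fin m) → Arc D (vert (inject₁ i)) (vert (suc i))

DistLe : (D : Digraph) → V D → V D → ℕ → Set
DistLe D u v r = Σ ℕ λ m → m ≤ r × Path D u v m

DistEq : (D : Digraph) → V D → V D → ℕ → Set
DistEq D u v r = Path D u v r × (∀ m → m < r → ¬ Path D u v m)

IsKing : (D : Digraph) → ℕ → V D → Set
IsKing D r v = ∀ (w : V D) → DistLe D v w r

KQuasiTransitive : ℕ → Digraph → Set
KQuasiTransitive k D =
  ∀ {u v} → Path D u v k → Arc D u v ⊎ Arc D v u

Reachable : (D : Digraph) → V D → V D → Set
Reachable D u v = Σ ℕ λ m → Path D u v m

IsStrongComponent : (D : Digraph) → (V D → Set) → Set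
IsStrongComponent D S =
  (Σ (V D) S)
  × (∀ x y → S x → S y → Reachable D x y)
  × (∀ x y → S x → Reachable D x y → Reachable D y x → S y)

IsInitialStrongComponent : (D : Digraph) → (V D → Set) → Set
IsInitialStrongComponent D S =
  IsStrongComponent D S × (∀ x y → Arc D x y → S y → S x)

IsUniqueInitialStrongComponent : (D : Digraph) → (V D → Set) → Set₁
IsUniqueInitialStrongComponent D C =
  IsInitialStrongComponent D C
  × (∀ (C' : V D → Set) → IsInitialStrongComponent D C' →
       ∀ x → (C' x → C x) × (C x → C' x))

Odd : ℕ → Set
Odd k = Σ ℕ λ j → k ≡ suc (2 * j)

-- Measure levels by the distance from a fixed vertex u.  In a k-quasi-transitive
-- digraph a path of length k whose endpoints lie at least two levels apart is closed
-- by the arc from the higher endpoint to the lower one, since the opposite arc would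
-- shorten a geodesic from u.  Paths glued from geodesic segments with disjoint level
-- ranges repeat no vertex, and such paths give arcs x_{i+k+2j} → x_i back along every
-- geodesic x from u, and arcs from a vertex far from u into the geodesic towards any
-- other vertex.  Hence if u is an E-king with E ≥ k + 2, every vertex at distance E
-- from u is an (E − 1)-king.  A vertex of C reaches everything, so descending from it
-- inside C gives a (k + 1)-king of C.  If some vertex of C is not a (k + 1)-king, a
-- walk from it to that king crosses an arc u₂ → u₁ from a non-king to a king; u₂ is a
-- (k + 2)-king, and as k − 3 is even the back arcs chain two levels at a time, which
-- makes every vertex at distance k + 2 from u₂ a 4-king.

module Submission where

open import Defs
open import Data.Nat using (ℕ; zero; suc; _+_; _*_; _∸_; _≤_; _<_; z≤n; s≤s; _≤?_)
open import Data.Nat.Properties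
open import Data.Nat.Induction using (<-rec)
open import Data.Nat.Tactic.RingSolver using (solve)
open import Data.Bool using (true)
open import Data.Bool.Properties using () renaming (_≟_ to _≟ᵇ_)
open import Data.Empty using (⊥-elim)
open import Data.Unit using (⊤; tt)
open import Data.Product using (Σ; ∃; _×_; _,_; proj₁; proj₂)
open import Data.Sum using (_⊎_; inj₁; inj₂; [_,_]′)
open import Data.List using (_∷_; [])
open import Data.Vec using (tabulate)
open import Data.Vec.Properties using (lookup∘tabulate; lookup⇒[]=; []=⇒lookup)
open import Data.Fin using (Fin; zero; suc; toℕ)
open import Data.Fin.Properties
  using (any?; all?; ¬∀⟶∃¬; injective⇒≤; toℕ-injective; toℕ-fromℕ; toℕ-inject₁; toℕ<n)
  renaming (_≟_ to _≟ᶠ_; suc-injective to fsuc-injective)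
open import Data.Fin.Subset using (Subset; _⊂_) renaming (_∈_ to _∈ˢ_)
open import Data.Fin.Subset.Induction using (⊂-wellFounded; Acc; acc)
open import Function using (_∘_)
open import Relation.Nullary using (¬_; Dec; yes; no; does; _×-dec_; ¬?)
open import Relation.Nullary.Decidable using (dec-true; decidable-stable)
open import Relation.Binary.Definitions using (tri<; tri≈; tri>)
open import Relation.Binary.PropositionalEquality

parity : ∀ n → (∃ λ j → n ≡ 2 * j) ⊎ (∃ λ j → n ≡ suc (2 * j))
parity zero    = inj₁ (0 , refl)
parity (suc n) with parity n
... | inj₁ (j , n≡2j)   = inj₂ (j , cong suc n≡2j)
... | inj₂ (j , n≡2j+1) = inj₁ (suc j , trans (cong suc n≡2j+1) (solve (j ∷ [])))

half : ∀ m → ∃ λ i → 2 * i ≤ m × m ≤ suc (2 * i)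
half m with parity m
... | inj₁ (i , m≡2i)   = i , ≤-reflexive (sym m≡2i) , ≤-trans (≤-reflexive m≡2i) (n≤1+n _)
... | inj₂ (i , m≡2i+1) = i , ≤-trans (n≤1+n _) (≤-reflexive (sym m≡2i+1)) , ≤-reflexive m≡2i+1

2*m≤1+2*n⇒m≤n : ∀ {m n} → 2 * m ≤ suc (2 * n) → m ≤ n
2*m≤1+2*n⇒m≤n {m} {n} 2m≤1+2n =
  ≤-pred (*-cancelˡ-< 2 m (suc n) (s≤s (≤-trans 2m≤1+2n (≤-reflexive (solve (n ∷ []))))))

1+m∸n≤o : ∀ {m n o} → 2 ≤ n → n ≤ m → m ≤ suc o → suc (m ∸ n) ≤ o
1+m∸n≤o {m} {n} {o} 2≤n n≤m m≤1+o = ≤-pred (begin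
  2 + (m ∸ n) ≤⟨ +-monoˡ-≤ (m ∸ n) 2≤n ⟩
  n + (m ∸ n) ≡⟨ m+[n∸m]≡n n≤m ⟩
  m           ≤⟨ m≤1+o ⟩
  suc o       ∎)
  where open ≤-Reasoning

m+o≡n⇒m≤n : ∀ {m n} o → m + o ≡ n → m ≤ n
m+o≡n⇒m≤n o refl = m≤m+n _ o

_∈[_,_] : ℕ → ℕ → ℕ → Set
ℓ ∈[ i , j ] = i ≤ ℓ × ℓ ≤ j

module Walks (D : Digraph) where

  infixr 5 _∷_ _++_
  infix 4 _∈_

  data Walk : V D → V D → ℕ → Set where
    []  : ∀ {a} → Walk a a 0
    _∷_ : ∀ {a b c m} → Arc D a b → Walk b c m → Walk a c (suc m)

  private variable
    a b c x y : V D
    m m′ r r′ ℓ ℓ′ : ℕ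

  _++_ : Walk a b m → Walk b c m′ → Walk a c (m + m′)
  []      ++ w′ = w′
  (e ∷ w) ++ w′ = e ∷ (w ++ w′)

  cast : m ≡ m′ → Walk a b m → Walk a b m′
  cast refl w = w

  _∷ʳ_ : Walk a b m → Arc D b c → Walk a c (suc m)
  _∷ʳ_ {m = m} w e = cast (+-comm m 1) (w ++ e ∷ [])

  _at_ : Walk a b m → ℕ → V D
  ([] {a})      at _     = a
  (_∷_ {a} _ _) at zero  = a
  (_ ∷ w)       at suc i = w at i

  at-start : (w : Walk a b m) → w at 0 ≡ a
  at-start []      = refl
  at-start (_ ∷ _) = refl

  at-end : (w : Walk a b m) → w at m ≡ b
  at-end []      = refl
  at-end (_ ∷ w) = at-end w

  at-arc : (w : Walk a b m) → ∀ {j} → j < m → Arc D (w at j) (w at suc j)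
  at-arc (e ∷ w) {zero}  _         = subst (Arc D _) (sym (at-start w)) e
  at-arc (_ ∷ w) {suc j} (s≤s j<m) = at-arc w j<m

  prefix : (w : Walk a b m) → ∀ j → j ≤ m → Walk a (w at j) j
  prefix []      zero    _         = []
  prefix (_ ∷ _) zero    _         = []
  prefix (e ∷ w) (suc j) (s≤s j≤m) = e ∷ prefix w j j≤m

  suffix : (w : Walk a b m) → ∀ j → Walk (w at j) b (m ∸ j)
  suffix []      zero    = []
  suffix []      (suc j) = []
  suffix (e ∷ w) zero    = e ∷ w
  suffix (_ ∷ w) (suc j) = suffix w j

  _∈_ : V D → Walk a b m → Set
  x ∈ [] {a}      = x ≡ a
  x ∈ _∷_ {a} _ w = x ≡ a ⊎ x ∈ w

  _∈?_ : (x : V D) (w : Walk a b m) → Dec (x ∈ w)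
  x ∈? [] {a}      = x ≟ᶠ a
  x ∈? _∷_ {a} _ w with x ≟ᶠ a | x ∈? w
  ... | yes x≡a | _      = yes (inj₁ x≡a)
  ... | no _    | yes x∈w = yes (inj₂ x∈w)
  ... | no x≢a  | no x∉w  = no λ { (inj₁ x≡a) → x≢a x≡a ; (inj₂ x∈w) → x∉w x∈w }

  at-∈ : (w : Walk a b m) → ∀ i → w at i ∈ w
  at-∈ []      _       = refl
  at-∈ (_ ∷ _) zero    = inj₁ refl
  at-∈ (_ ∷ w) (suc i) = inj₂ (at-∈ w i)

  IsPath : Walk a b m → Set
  IsPath []             = ⊤
  IsPath (_∷_ {a} _ w) = ¬ a ∈ w × IsPath w

  _++⟨_⟩_ : Walk a b m → Arc D b c → Walk c x m′ → Walk a x (m + suc m′)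
  w ++⟨ e ⟩ w′ = w ++ e ∷ w′

  ∈-++⟨⟩⁻ : (w : Walk a b m) {e : Arc D b c} {w′ : Walk c x m′} → y ∈ w ++⟨ e ⟩ w′ → y ∈ w ⊎ y ∈ w′
  ∈-++⟨⟩⁻ []      (inj₁ y≡b)  = inj₁ y≡b
  ∈-++⟨⟩⁻ []      (inj₂ y∈w′) = inj₂ y∈w′
  ∈-++⟨⟩⁻ (_ ∷ _) (inj₁ y≡a)  = inj₁ (inj₁ y≡a)
  ∈-++⟨⟩⁻ (_ ∷ w) (inj₂ y∈)   with ∈-++⟨⟩⁻ w y∈
  ... | inj₁ y∈w  = inj₁ (inj₂ y∈w)
  ... | inj₂ y∈w′ = inj₂ y∈w′

  ++⟨⟩-isPath : (w : Walk a b m) {e : Arc D b c} {w′ : Walk c x m′} → IsPath w → IsPath w′ →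
                (∀ {y} → y ∈ w → ¬ y ∈ w′) → IsPath (w ++⟨ e ⟩ w′)
  ++⟨⟩-isPath []      _           p′ disjoint = disjoint refl , p′
  ++⟨⟩-isPath (_ ∷ w) (a∉w , p) p′ disjoint =
    [ a∉w , disjoint (inj₁ refl) ]′ ∘ ∈-++⟨⟩⁻ w , ++⟨⟩-isPath w p p′ (disjoint ∘ inj₂)

  suffix-from : (w : Walk a c m) → x ∈ w →
                Σ ℕ λ m′ → m′ ≤ m × Σ (Walk x c m′) λ w′ → (IsPath w → IsPath w′)
  suffix-from []      refl        = 0 , z≤n , [] , λ _ → tt
  suffix-from (e ∷ w) (inj₁ refl) = _ , ≤-refl , e ∷ w , λ p → p
  suffix-from (e ∷ w) (inj₂ x∈w) with suffix-from w x∈w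
  ... | m′ , m′≤m , w′ , path = m′ , m≤n⇒m≤1+n m′≤m , w′ , λ p → path (proj₂ p)

  shortcut : Walk a b m → Σ ℕ λ m′ → m′ ≤ m × Σ (Walk a b m′) IsPath
  shortcut []                = 0 , z≤n , [] , tt
  shortcut (_∷_ {a} e w) with shortcut w
  ... | m′ , m′≤m , w′ , p with a ∈? w′
  ...   | yes a∈w′ = let (m″ , m″≤m′ , w″ , path) = suffix-from w′ a∈w′
                     in m″ , ≤-trans m″≤m′ (m≤n⇒m≤1+n m′≤m) , w″ , path p
  ...   | no a∉w′  = suc m′ , s≤s m′≤m , e ∷ w′ , a∉w′ , p

  at-injective : (w : Walk a b m) → IsPath w → ∀ {i j} → i ≤ m → j ≤ m → w at i ≡ w at j → i ≡ j
  at-injective []      _         {zero}  {zero}  _ _ _ = refl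
  at-injective (_ ∷ _) _         {zero}  {zero}  _ _ _ = refl
  at-injective (_ ∷ w) (a∉w , _) {zero}  {suc j} _ _ eq = ⊥-elim (a∉w (subst (_∈ w) (sym eq) (at-∈ w j)))
  at-injective (_ ∷ w) (a∉w , _) {suc i} {zero}  _ _ eq = ⊥-elim (a∉w (subst (_∈ w) eq (at-∈ w i)))
  at-injective (_ ∷ w) (_ , p)   {suc i} {suc j} (s≤s i≤m) (s≤s j≤m) eq =
    cong suc (at-injective w p i≤m j≤m eq)

  toPath : (w : Walk a b m) → IsPath w → Path D a b m
  toPath {m = m} w p = record
    { vert     = λ i → w at toℕ i
    ; distinct = λ {i} {j} eq → toℕ-injective (at-injective w p (bound i) (bound j) eq)
    ; start    = at-start w
    ; end      = subst (λ j → w at j ≡ _) (sym (toℕ-fromℕ m)) (at-end w)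
    ; arcs     = λ i → subst (λ j → Arc D (w at j) (w at suc (toℕ i))) (sym (toℕ-inject₁ i))
                           (at-arc w (toℕ<n i))
    }
    where
    bound : (i : Fin (suc m)) → toℕ i ≤ m
    bound i = ≤-pred (toℕ<n i)

  fromPath : Path D a b m → Walk a b m
  fromPath {a} {m = zero} p = subst (λ y → Walk a y 0) (trans (sym (Path.start p)) (Path.end p)) []
  fromPath {m = suc m} p = subst (λ x → Arc D x _) (Path.start p) (Path.arcs p zero) ∷ fromPath tail
    where
    tail : Path D (Path.vert p (suc zero)) _ m
    tail = record
      { vert     = λ i → Path.vert p (suc i)
      ; distinct = λ eq → fsuc-injective (Path.distinct p eq)
      ; start    = refl
      ; end      = Path.end p
      ; arcs     = λ i → Path.arcs p (suc i)
      }

  path-length< : (w : Walk a b m) → IsPath w → m < n D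
  path-length< w p = injective⇒≤ (Path.distinct (toPath w p))

  arc? : ∀ a b → Dec (Arc D a b)
  arc? a b = arc D a b ≟ᵇ true

  walk? : ∀ a b m → Dec (Walk a b m)
  walk? a b zero with a ≟ᶠ b
  ... | yes refl = yes []
  ... | no a≢b   = no λ { [] → a≢b refl }
  walk? a b (suc m) with any? (λ c → arc? a c ×-dec walk? c b m)
  ... | yes (_ , e , w) = yes (e ∷ w)
  ... | no ∄            = no λ { (e ∷ w) → ∄ (_ , e , w) }

  reachable : Walk a b m → Reachable D a b
  reachable w = let (m′ , _ , w′ , p) = shortcut w in m′ , toPath w′ p

  reachable-refl : Reachable D a a
  reachable-refl = reachable []

  reachable-trans : Reachable D a b → Reachable D b c → Reachable D a c
  reachable-trans (_ , p) (_ , p′) = reachable (fromPath p ++ fromPath p′)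

  reachable? : ∀ a b → Dec (Reachable D a b)
  reachable? a b with anyUpTo? (walk? a b) (n D)
  ... | yes (_ , _ , w) = yes (reachable w)
  ... | no ∄            = no λ (_ , p) →
    let (m , _ , w , w-path) = shortcut (fromPath p) in ∄ (m , path-length< w w-path , w)

  distLe : Walk a b m → m ≤ r → DistLe D a b r
  distLe w m≤r = let (m′ , m′≤m , w′ , p) = shortcut w in m′ , ≤-trans m′≤m m≤r , toPath w′ p

  distLe? : ∀ a b r → Dec (DistLe D a b r)
  distLe? a b r with anyUpTo? (walk? a b) (suc r)
  ... | yes (_ , m<1+r , w) = yes (distLe w (≤-pred m<1+r))
  ... | no ∄                = no λ (m , m≤r , p) → ∄ (m , s≤s m≤r , fromPath p)

  Dist : V D → V D → ℕ → Set
  Dist a b ℓ = Walk a b ℓ × (∀ t → t < ℓ → ¬ Walk a b t)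

  dist-unique : Dist a b ℓ → Dist a b ℓ′ → ℓ ≡ ℓ′
  dist-unique {ℓ = ℓ} {ℓ′} (w , min) (w′ , min′) with <-cmp ℓ ℓ′
  ... | tri< ℓ<ℓ′ _ _ = ⊥-elim (min′ ℓ ℓ<ℓ′ w)
  ... | tri≈ _ ℓ≡ℓ′ _ = ℓ≡ℓ′
  ... | tri> _ _ ℓ′<ℓ = ⊥-elim (min ℓ′ ℓ′<ℓ w′)

  shortest : Walk a b m → Σ ℕ λ ℓ → ℓ ≤ m × Dist a b ℓ
  shortest {a} {b} {m} = <-rec (λ m → Walk a b m → Σ ℕ λ ℓ → ℓ ≤ m × Dist a b ℓ) go m
    where
    go : ∀ m → (∀ {t} → t < m → Walk a b t → Σ ℕ λ ℓ → ℓ ≤ t × Dist a b ℓ) →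
         Walk a b m → Σ ℕ λ ℓ → ℓ ≤ m × Dist a b ℓ
    go m shorter w with anyUpTo? (walk? a b) m
    ... | yes (t , t<m , w′) = let (ℓ , ℓ≤t , d) = shorter t<m w′ in ℓ , ≤-trans ℓ≤t (<⇒≤ t<m) , d
    ... | no ∄               = m , ≤-refl , w , λ t t<m w′ → ∄ (t , t<m , w′)

  dist-arc : Dist a x ℓ → Dist a y ℓ′ → Arc D x y → ℓ′ ≤ suc ℓ
  dist-arc {ℓ = ℓ} {ℓ′ = ℓ′} (w , _) (_ , min′) e with ℓ′ ≤? suc ℓ
  ... | yes ℓ′≤1+ℓ = ℓ′≤1+ℓ
  ... | no ℓ′≰1+ℓ  = ⊥-elim (min′ (suc ℓ) (≰⇒> ℓ′≰1+ℓ) (w ∷ʳ e))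

  dist-prefix : ((w , _) : Dist a b m) → ∀ {j} → j ≤ m → Dist a (w at j) j
  dist-prefix {m = m} (w , min) {j} j≤m = prefix w j j≤m , λ t t<j w′ →
    min (t + (m ∸ j)) (shorter t<j) (w′ ++ suffix w j)
    where
    shorter : ∀ {t} → t < j → t + (m ∸ j) < m
    shorter {t} t<j = begin-strict
      t + (m ∸ j) <⟨ +-monoˡ-< (m ∸ j) t<j ⟩
      j + (m ∸ j) ≡⟨ m+[n∸m]≡n j≤m ⟩
      m           ∎
      where open ≤-Reasoning

  dist⇒distEq : Dist a b ℓ → DistEq D a b ℓ
  dist⇒distEq {a} {b} (w , min) with shortcut w
  ... | ℓ′ , ℓ′≤ℓ , w′ , p with m≤n⇒m<n∨m≡n ℓ′≤ℓ
  ...   | inj₁ ℓ′<ℓ  = ⊥-elim (min _ ℓ′<ℓ w′)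
  ...   | inj₂ refl  = toPath w′ p , λ t t<ℓ q → min t t<ℓ (fromPath q)

  distEq⇒dist : DistEq D a b ℓ → Dist a b ℓ
  distEq⇒dist (p , min) = fromPath p , λ t t<ℓ w →
    let (t′ , t′≤t , w′ , w′-path) = shortcut w in min t′ (≤-<-trans t′≤t t<ℓ) (toPath w′ w′-path)

  crossing : {P : V D → Set} → (∀ v → Dec (P v)) → Walk a b m → ¬ P a → P b →
             ∃ λ a′ → ∃ λ b′ → Arc D a′ b′ × ¬ P a′ × P b′ × Reachable D a a′ × Reachable D b′ b
  crossing P? []                 ¬Pa Pb = ⊥-elim (¬Pa Pb)
  crossing P? (_∷_ {b = c} e w) ¬Pa Pb with P? c
  ... | yes Pc  = _ , c , e , ¬Pa , Pc , reachable-refl , reachable w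
  ... | no  ¬Pc =
    let (a′ , b′ , e′ , ¬Pa′ , Pb′ , c↝a′ , b′↝b) = crossing P? w ¬Pc Pb
    in a′ , b′ , e′ , ¬Pa′ , Pb′ , reachable (e ∷ fromPath (proj₂ c↝a′)) , b′↝b

  dist-exact : DistLe D a b (suc r) → ¬ DistLe D a b r → Dist a b (suc r)
  dist-exact {r = r} (m , m≤1+r , p) far with m≤n⇒m<n∨m≡n m≤1+r
  ... | inj₁ m<1+r = ⊥-elim (far (m , ≤-pred m<1+r , p))
  ... | inj₂ refl  = fromPath p , λ t t<1+r w → far (distLe w (≤-pred t<1+r))

  king? : ∀ r a → Dec (IsKing D r a)
  king? r a = all? (λ b → distLe? a b r)

  king-mono : r ≤ r′ → IsKing D r a → IsKing D r′ a
  king-mono r≤r′ king y = let (m , m≤r , p) = king y in m , ≤-trans m≤r r≤r′ , p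

  king-dist : IsKing D r a → ∀ y → Σ ℕ λ m → m ≤ r × Dist a y m
  king-dist king y =
    let (m , m≤r , p) = king y ; (ℓ , ℓ≤m , d) = shortest (fromPath p) in ℓ , ≤-trans ℓ≤m m≤r , d

  king-reachable : IsKing D r a → ∀ y → Reachable D a y
  king-reachable king y = let (m , _ , p) = king y in m , p

module Levelled (D : Digraph) (u : V D) where
  open Walks D

  private variable
    a b c d z : V D
    m m′ M ℓ lo hi lo′ hi′ : ℕ
    L L′ : ℕ → Set

  -- Levels are distances from u; a vertex has only one level, so walks whose
  -- level sets are disjoint share no vertex.
  Levels : (ℕ → Set) → Walk a b m → Set
  Levels L w = ∀ {v} → v ∈ w → ∃ λ ℓ → L ℓ × Dist u v ℓ

  levels-mono : (∀ {ℓ} → L ℓ → L′ ℓ) → {w : Walk a b m} → Levels L w → Levels L′ w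
  levels-mono L⊆L′ levels v∈w = let (ℓ , Lℓ , d) = levels v∈w in ℓ , L⊆L′ Lℓ , d

  LevelledPath : V D → V D → ℕ → ℕ → ℕ → Set
  LevelledPath a b m lo hi = Σ (Walk a b m) λ w → IsPath w × Levels (_∈[ lo , hi ]) w

  lo≤hi : LevelledPath a b m lo hi → lo ≤ hi
  lo≤hi ([]    , _ , levels) = let (_ , (lo≤ℓ , ℓ≤hi) , _) = levels refl in ≤-trans lo≤ℓ ℓ≤hi
  lo≤hi (_ ∷ _ , _ , levels) = let (_ , (lo≤ℓ , ℓ≤hi) , _) = levels (inj₁ refl) in ≤-trans lo≤ℓ ℓ≤hi

  recast : m ≡ m′ → LevelledPath a b m lo hi → LevelledPath a b m′ lo hi
  recast refl p = p

  vertex : Dist u a ℓ → LevelledPath a a 0 ℓ ℓ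
  vertex d = [] , tt , λ { refl → _ , (≤-refl , ≤-refl) , d }

  join : (p : LevelledPath a b m lo hi) → Arc D b c → (p′ : LevelledPath c d m′ lo′ hi′) →
         (∀ {ℓ} → ℓ ∈[ lo , hi ] → ¬ ℓ ∈[ lo′ , hi′ ]) →
         Σ (Walk a d (m + suc m′)) λ w → IsPath w × Levels (λ ℓ → ℓ ∈[ lo , hi ] ⊎ ℓ ∈[ lo′ , hi′ ]) w
  join (w , p , levels) e (w′ , p′ , levels′) disjoint =
    w ++⟨ e ⟩ w′ , ++⟨⟩-isPath w p p′ apart ,
    λ v∈ → [ levels-mono inj₁ levels , levels-mono inj₂ levels′ ]′ (∈-++⟨⟩⁻ w v∈)
    where
    apart : ∀ {v} → v ∈ w → ¬ v ∈ w′
    apart v∈w v∈w′ =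
      let (ℓ , ℓ∈ , dℓ) = levels v∈w ; (ℓ′ , ℓ′∈ , dℓ′) = levels′ v∈w′
      in disjoint ℓ∈ (subst (_∈[ _ , _ ]) (dist-unique dℓ′ dℓ) ℓ′∈)

  join-up : LevelledPath a b m lo hi → Arc D b c → LevelledPath c d m′ lo′ hi′ → hi < lo′ →
            LevelledPath a d (m + suc m′) lo hi′
  join-up {lo = lo} {hi} {lo′ = lo′} {hi′} p e p′ hi<lo′ with join p e p′ (λ (_ , ℓ≤hi) (lo′≤ℓ , _) → <⇒≱ hi<lo′ (≤-trans lo′≤ℓ ℓ≤hi))
  ... | w , path , levels = w , path , levels-mono [ first , second ]′ levels
    where
    hi≤hi′ = ≤-trans (<⇒≤ hi<lo′) (lo≤hi p′)
    lo≤lo′ = ≤-trans (lo≤hi p) (<⇒≤ hi<lo′)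
    first : ∀ {ℓ} → ℓ ∈[ lo , hi ] → ℓ ∈[ lo , hi′ ]
    first (lo≤ℓ , ℓ≤hi) = lo≤ℓ , ≤-trans ℓ≤hi hi≤hi′
    second : ∀ {ℓ} → ℓ ∈[ lo′ , hi′ ] → ℓ ∈[ lo , hi′ ]
    second (lo′≤ℓ , ℓ≤hi′) = ≤-trans lo≤lo′ lo′≤ℓ , ℓ≤hi′

  join-down : LevelledPath a b m lo hi → Arc D b c → LevelledPath c d m′ lo′ hi′ → hi′ < lo →
              LevelledPath a d (m + suc m′) lo′ hi
  join-down {lo = lo} {hi} {lo′ = lo′} {hi′} p e p′ hi′<lo with join p e p′ (λ (lo≤ℓ , _) (_ , ℓ≤hi′) → <⇒≱ hi′<lo (≤-trans lo≤ℓ ℓ≤hi′))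
  ... | w , path , levels = w , path , levels-mono [ first , second ]′ levels
    where
    lo′≤lo = ≤-trans (lo≤hi p′) (<⇒≤ hi′<lo)
    hi′≤hi = ≤-trans (<⇒≤ hi′<lo) (lo≤hi p)
    first : ∀ {ℓ} → ℓ ∈[ lo , hi ] → ℓ ∈[ lo′ , hi ]
    first (lo≤ℓ , ℓ≤hi) = ≤-trans lo′≤lo lo≤ℓ , ℓ≤hi
    second : ∀ {ℓ} → ℓ ∈[ lo′ , hi′ ] → ℓ ∈[ lo′ , hi ]
    second (lo′≤ℓ , ℓ≤hi′) = lo′≤ℓ , ≤-trans ℓ≤hi′ hi′≤hi

  module _ (geo : Dist u z M) where
    private
      x : ℕ → V D
      x = proj₁ geo at_

    segment : ∀ s t {e} → s + t ≡ e → e ≤ M → LevelledPath (x s) (x e) t s e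
    segment s zero    s+0≡e e≤M =
      subst (λ e → LevelledPath (x s) (x e) 0 s e) (trans (sym (+-identityʳ s)) s+0≡e)
        (vertex (dist-prefix geo (subst (_≤ M) (trans (sym s+0≡e) (+-identityʳ s)) e≤M)))
    segment s (suc t) s+t≡e e≤M =
      join-up (vertex (dist-prefix geo s≤M)) (at-arc (proj₁ geo) s<M)
              (segment (suc s) t (trans (sym (+-suc s t)) s+t≡e) e≤M) ≤-refl
      where
      s<M : suc s ≤ M
      s<M = ≤-trans (m+o≡n⇒m≤n t (trans (sym (+-suc s t)) s+t≡e)) e≤M
      s≤M = <⇒≤ s<M

module QuasiTransitivity (D : Digraph) {k} (qt : KQuasiTransitive k D) where
  open Walks D

  private variable
    u a b : V D
    α β : ℕ

  -- The arc from the nearer to the farther endpoint would be a shortcut from u.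
  descending-arc : (w : Walk a b k) → IsPath w → Dist u a α → Dist u b β → 2 + β ≤ α → Arc D a b
  descending-arc w p da db 2+β≤α with qt (toPath w p)
  ... | inj₁ ab = ab
  ... | inj₂ ba = ⊥-elim (<⇒≱ 2+β≤α (dist-arc db da ba))

  ascending-arc : (w : Walk a b k) → IsPath w → Dist u a α → Dist u b β → 2 + α ≤ β → Arc D b a
  ascending-arc w p da db 2+α≤β with qt (toPath w p)
  ... | inj₁ ab = ⊥-elim (<⇒≱ 2+α≤β (dist-arc da db ab))
  ... | inj₂ ba = ba

module Rooted (D : Digraph) (q : ℕ) (qt : KQuasiTransitive (3 + q) D) (u : V D) where
  open Walks D
  open Levelled D u
  open QuasiTransitivity D qt

  -- The ring solver does not unfold k, so the equations it proves mention 3 + q.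
  k : ℕ
  k = 3 + q

  private variable
    a b : V D
    α β lo hi : ℕ

  descend : LevelledPath a b k lo hi → Dist u a α → Dist u b β → 2 + β ≤ α → Arc D a b
  descend (w , p , _) = descending-arc w p

  ascend : LevelledPath a b k lo hi → Dist u a α → Dist u b β → 2 + α ≤ β → Arc D b a
  ascend (w , p , _) = ascending-arc w p

  2+i≤i+k : ∀ i → 2 + i ≤ i + (3 + q)
  2+i≤i+k i = m+o≡n⇒m≤n (suc q) (solve (i ∷ q ∷ []))

  offset-parity : ∀ {E} → k ≤ E → (∃ λ j → E ≡ 2 * j + k) ⊎ (∃ λ j → E ≡ 1 + (2 * j + k))
  offset-parity {E} k≤E with parity (E ∸ k)
  ... | inj₁ (j , d≡2j)   = inj₁ (j , trans (sym (m∸n+n≡m k≤E)) (cong (_+ k) d≡2j))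
  ... | inj₂ (j , d≡2j+1) = inj₂ (j , trans (sym (m∸n+n≡m k≤E)) (cong (_+ k) d≡2j+1))

  module Geodesic {z E} (geo : Dist u z E) where
    x : ℕ → V D
    x = proj₁ geo at_

    dx : ∀ {i} → i ≤ E → Dist u (x i) i
    dx = dist-prefix geo

    x-start : x 0 ≡ u
    x-start = at-start (proj₁ geo)

    x-end : x E ≡ z
    x-end = at-end (proj₁ geo)

    back-arc : ∀ i → i + k ≤ E → Arc D (x (i + k)) (x i)
    back-arc i i+k≤E =
      ascend (segment geo i k refl i+k≤E) (dx (≤-trans (m≤m+n i k) i+k≤E)) (dx i+k≤E) (2+i≤i+k i)

    level-k→root : k ≤ E → Arc D (x k) u
    level-k→root k≤E = subst (Arc D (x k)) x-start (back-arc 0 k≤E)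

    -- x_A → x_{i+2} (the case j), the geodesic up to x_{i+k} and its back arc to x_i
    -- form a k-path from level A down to level i.
    back-arc-odd : ∀ j i → i + (2 * j + k) ≤ E → Arc D (x (i + (2 * j + k))) (x i)
    back-arc-odd zero    i = back-arc i
    back-arc-odd (suc j) i A≤E = descend path (dx A≤E) (dx i≤E) (≤-trans (2+i≤i+k i) (<⇒≤ i+k<A))
      where
      A = i + (2 * suc j + k)
      i+k<A : suc (i + (3 + q)) ≤ i + (2 * suc j + (3 + q))
      i+k<A = m+o≡n⇒m≤n (suc (2 * j)) (solve (i ∷ j ∷ q ∷ []))
      i+k≤E = ≤-trans (<⇒≤ i+k<A) A≤E
      i≤E = ≤-trans (m≤m+n i k) i+k≤E
      shift : (2 + i) + (2 * j + (3 + q)) ≡ i + (2 * suc j + (3 + q))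
      shift = solve (i ∷ j ∷ q ∷ [])
      middle : (2 + i) + suc q ≡ i + (3 + q)
      middle = solve (i ∷ q ∷ [])
      to-middle : Arc D (x A) (x (2 + i))
      to-middle = subst (λ t → Arc D (x t) (x (2 + i))) shift
                    (back-arc-odd j (2 + i) (subst (_≤ E) (sym shift) A≤E))
      path = recast (cong (2 +_) (+-comm q 1))
        (join-down (vertex (dx A≤E)) to-middle
           (join-down (segment geo (2 + i) (suc q) middle i+k≤E) (back-arc i i+k≤E) (vertex (dx i≤E))
                      (n≤1+n (suc i)))
           i+k<A)

    arc-to-root : ∀ j → E ≡ 2 * j + k → Arc D z u
    arc-to-root j E≡ =
      subst₂ (Arc D) (trans (cong x (sym E≡)) x-end) x-start (back-arc-odd j 0 (≤-reflexive (sym E≡)))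

    arc-to-level-k : ∀ j → E ≡ 1 + (2 * suc j + k) → Arc D z (x k)
    arc-to-level-k j E≡ = descend path geo (dx (<⇒≤ k<E)) 2+k≤E
      where
      2+k≤1+2j+k : 2 + (3 + q) ≤ 1 + (2 * suc j + (3 + q))
      2+k≤1+2j+k = m+o≡n⇒m≤n (suc (2 * j)) (solve (j ∷ q ∷ []))
      2+k≤E = subst (2 + k ≤_) (sym E≡) 2+k≤1+2j+k
      k<E = ≤-trans (n≤1+n _) 2+k≤E
      to-x₁ : Arc D z (x 1)
      to-x₁ = subst (λ v → Arc D v (x 1)) (trans (cong x (sym E≡)) x-end)
                (back-arc-odd (suc j) 1 (≤-reflexive (sym E≡)))
      path = join-down (vertex geo) to-x₁ (segment geo 1 (2 + q) refl (<⇒≤ k<E)) k<E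

  module Towards {w F} (dw : Dist u w F) {y m} (dy : Dist u y m) where
    open Geodesic dw

    ys : ℕ → V D
    ys = proj₁ dy at_

    into-start : ∀ {v} → Arc D v u → Arc D v (ys 0)
    into-start = subst (Arc D _) (sym (at-start (proj₁ dy)))

    onto : ∀ {J} → Arc D w (ys J) → Walk w y (suc (m ∸ J))
    onto {J} e = e ∷ suffix (proj₁ dy) J

    jump : ∀ s → Arc D w (ys s) → s + (2 + q) ≤ m → 2 + (s + (2 + q)) ≤ F → Arc D w (ys (s + (2 + q)))
    jump s e bound far = descend path dw (dist-prefix dy bound) far
      where
      path = join-down (vertex dw) e (segment dy s (2 + q) refl bound) (≤-trans (n≤1+n _) far)

    via-level-k : Arc D w (x k) → suc q ≤ m → 2 + k ≤ F → Arc D w (ys (suc q))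
    via-level-k e bound far =
      descend path dw (dist-prefix dy bound) (≤-trans (+-monoʳ-≤ 2 (m≤n+m (suc q) 2)) far)
      where
      k<F = ≤-trans (n≤1+n _) far
      path = join-down (vertex dw) e
               (join-down (vertex (dx (<⇒≤ k<F))) (into-start (level-k→root (<⇒≤ k<F)))
                          (segment dy 0 (suc q) refl bound) (n≤1+n _))
               k<F

    turn : ∀ o J c → c + J ≡ q → Arc D (x (o + k)) (ys o) → Arc D w (x (o + (2 + J))) →
           o + J ≤ m → suc (o + k) ≤ F → Arc D w (ys (o + J))
    turn o J c c+J≡q back e bound far = descend (recast length path) dw (dist-prefix dy bound) 2+o+J≤F
      where
      reach : o + (2 + J) + suc c ≡ o + (3 + q)
      reach = begin
        o + (2 + J) + suc c ≡⟨ solve (o ∷ J ∷ c ∷ []) ⟩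
        o + (3 + (c + J))   ≡⟨ cong (λ t → o + (3 + t)) c+J≡q ⟩
        o + (3 + q)         ∎
        where open ≡-Reasoning
      length : suc (suc c + suc J) ≡ 3 + q
      length = begin
        suc (suc c + suc J) ≡⟨ solve (c ∷ J ∷ []) ⟩
        3 + (c + J)         ≡⟨ cong (3 +_) c+J≡q ⟩
        3 + q               ∎
        where open ≡-Reasoning
      below : suc (o + J) ≤ o + (2 + J)
      below = m+o≡n⇒m≤n 1 (solve (o ∷ J ∷ []))
      2+o+J≤F : 2 + (o + J) ≤ F
      2+o+J≤F = begin
        2 + (o + J)  ≡⟨ solve (o ∷ J ∷ []) ⟩
        o + (2 + J)  ≤⟨ m+o≡n⇒m≤n (suc c) reach ⟩
        o + (3 + q)  <⟨ far ⟩
        F            ∎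
        where open ≤-Reasoning
      path = join-down (vertex dw) e
               (join-down (segment dw (o + (2 + J)) (suc c) reach (<⇒≤ far)) back
                          (segment dy o J refl bound) below)
               far

  module _ {w F y m} (dw : Dist u w (suc F)) (dy : Dist u y m) (m≤1+F : m ≤ suc F) where
    open Geodesic dw
    open Towards dw dy

    reaches-via-root : Arc D w u → 2 + k ≤ suc F → DistLe D w y F
    reaches-via-root w→u far with suc m ≤? F
    ... | yes 1+m≤F = distLe (w→u ∷ proj₁ dy) 1+m≤F
    ... | no  1+m≰F =
      distLe (onto (jump 0 (into-start w→u) 2+q≤m (≤-trans (n≤1+n _) far)))
             (1+m∸n≤o (s≤s (s≤s z≤n)) 2+q≤m m≤1+F)
      where
      2+q≤m : 2 + q ≤ m
      2+q≤m = ≤-trans (m≤n+m (2 + q) 2) (≤-trans (≤-pred far) (≤-pred (≰⇒> 1+m≰F)))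

    reaches-via-level-k : Arc D w (x k) → 3 + k ≤ suc F → DistLe D w y F
    reaches-via-level-k w→xₖ far with suc (suc m) ≤? F
    ... | yes 2+m≤F = distLe (w→xₖ ∷ level-k→root (≤-trans (m≤n+m k 3) far) ∷ proj₁ dy) 2+m≤F
    ... | no  2+m≰F = from-y₁₊q (m≤n⇒m<n∨m≡n (z≤n {q}))
      where
      k≤m : k ≤ m
      k≤m = ≤-trans (n≤1+n k) (≤-pred (≤-trans (≤-pred far) (≤-pred (≰⇒> 2+m≰F))))
      1+q≤m = ≤-trans (m≤n+m (suc q) 2) k≤m
      w→y₁₊q = via-level-k w→xₖ 1+q≤m (≤-trans (n≤1+n _) far)
      -- For k = 3 this lands on y₁, too early to finish; one more jump reaches y₃.
      from-y₁₊q : 0 < q ⊎ 0 ≡ q → DistLe D w y F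
      from-y₁₊q (inj₁ 0<q) = distLe (onto w→y₁₊q) (1+m∸n≤o (s≤s 0<q) 1+q≤m m≤1+F)
      from-y₁₊q (inj₂ 0≡q) =
        distLe (onto (jump 1 w→y₁ k≤m (≤-trans (n≤1+n _) far))) (1+m∸n≤o (s≤s (s≤s z≤n)) k≤m m≤1+F)
        where
        w→y₁ = subst (λ t → Arc D w (ys (suc t))) (sym 0≡q) w→y₁₊q

  far-reaches : ∀ {w F y m} → Dist u w (suc F) → 2 + k ≤ suc F → Dist u y m → m ≤ suc F → DistLe D w y F
  far-reaches dw far dy m≤1+F with offset-parity (≤-trans (m≤n+m k 2) far)
  ... | inj₁ (j , F≡)     = reaches-via-root dw dy m≤1+F (Geodesic.arc-to-root dw j F≡) far
  ... | inj₂ (zero , F≡)  = ⊥-elim (1+n≰n (subst (2 + k ≤_) F≡ far))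
  ... | inj₂ (suc j , F≡) = reaches-via-level-k dw dy m≤1+F (Geodesic.arc-to-level-k dw j F≡)
                              (subst (3 + k ≤_) (sym F≡) 3+k≤1+2j+k)
    where
    3+k≤1+2j+k : 3 + (3 + q) ≤ 1 + (2 * suc j + (3 + q))
    3+k≤1+2j+k = m+o≡n⇒m≤n (2 * j) (solve (j ∷ q ∷ []))

  far-king : ∀ {w F} → Dist u w (suc F) → 2 + k ≤ suc F → IsKing D (suc F) u → IsKing D F w
  far-king dw far king y = let (_ , m≤1+F , dy) = king-dist king y in far-reaches dw far dy m≤1+F

  module _ {w} (dw : Dist u w (2 + k)) {H} (q≡2H : q ≡ 2 * H) where
    open Geodesic dw

    private
      w→u : Arc D w u
      w→u = arc-to-root 1 refl

    -- Two levels at a time: a k-path from w climbs the geodesic from x_{2i+4} to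
    -- x_{k+1}, drops to x₁ and climbs again to x_{2i+2}.
    even-arcs : ∀ d i → d + i ≡ H → Arc D w (x (2 + 2 * i))
    even-arcs zero i i≡H =
      subst (λ t → Arc D w (x (2 + t))) (trans q≡2H (cong (2 *_) (sym i≡H)))
        (jump 0 (into-start w→u) (m≤n+m (2 + q) 3) (+-monoʳ-≤ 2 (n≤1+n _)))
      where open Towards dw dw
    even-arcs (suc d) i d+i≡H =
      turn 1 (suc (2 * i)) (suc (2 * d)) c+J≡q (back-arc 1 (n≤1+n _))
        (subst (λ t → Arc D w (x t)) two-up (even-arcs d (suc i) (trans (+-suc d i) d+i≡H)))
        2i+2≤k+2 ≤-refl
      where
      open Towards dw dw
      two-up : 2 + 2 * suc i ≡ 1 + (2 + suc (2 * i))
      two-up = solve (i ∷ [])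
      c+J≡q : suc (2 * d) + suc (2 * i) ≡ q
      c+J≡q = begin
        suc (2 * d) + suc (2 * i) ≡⟨ solve (d ∷ i ∷ []) ⟩
        2 * (suc d + i)           ≡⟨ cong (2 *_) d+i≡H ⟩
        2 * H                     ≡⟨ sym q≡2H ⟩
        q                         ∎
        where open ≡-Reasoning
      2i+1≤q : suc (2 * i) ≤ q
      2i+1≤q = subst (suc (2 * i) ≤_) c+J≡q (m≤n+m (suc (2 * i)) (suc (2 * d)))
      2i+2≤k+2 : 2 + 2 * i ≤ 2 + k
      2i+2≤k+2 = +-monoʳ-≤ 2 (≤-trans (n≤1+n _) (≤-trans 2i+1≤q (m≤n+m q 3)))

    distance-k+2⇒within-4 : ∀ {y m} → Dist u y m → m ≤ 2 + k → DistLe D w y 4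
    distance-k+2⇒within-4 {y} {m} dy m≤2+k with 2 + q ≤? m
    ... | yes 2+q≤m =
      distLe (onto (jump 0 (into-start w→u) 2+q≤m (+-monoʳ-≤ 2 (n≤1+n _))))
             (s≤s (≤-trans (∸-monoˡ-≤ (2 + q) m≤2+k) (≤-reflexive (m+n∸n≡m 3 q))))
      where open Towards dw dy
    ... | no  2+q≰m with half m
    ...   | i , 2i≤m , m≤1+2i = distLe (onto w→y₂ᵢ) (s≤s (≤-trans m∸2i≤1 (s≤s z≤n)))
      where
      open Towards dw dy
      m∸2i≤1 : m ∸ 2 * i ≤ 1
      m∸2i≤1 = ≤-trans (∸-monoˡ-≤ (2 * i) m≤1+2i) (≤-reflexive (m+n∸n≡m 1 (2 * i)))
      i≤H : i ≤ H
      i≤H = 2*m≤1+2*n⇒m≤n (≤-trans 2i≤m (subst (λ t → m ≤ suc t) q≡2H (≤-pred (≰⇒> 2+q≰m))))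
      2i≤q : 2 * i ≤ q
      2i≤q = subst (2 * i ≤_) (sym q≡2H) (*-monoʳ-≤ 2 i≤H)
      w→y₂ᵢ : Arc D w (ys (2 * i))
      w→y₂ᵢ = turn 0 (2 * i) (q ∸ 2 * i) (m∸n+n≡m 2i≤q) (into-start (level-k→root (m≤n+m k 2)))
                (even-arcs (H ∸ i) i (m∸n+n≡m i≤H)) 2i≤m (n≤1+n _)

    distance-k+2⇒4-king : IsKing D (2 + k) u → IsKing D 4 w
    distance-k+2⇒4-king king y =
      let (_ , m≤2+k , dy) = king-dist king y in distance-k+2⇒within-4 dy m≤2+k

module InitialComponents (D : Digraph) where
  open Walks D using (_∷_; []; reachable; reachable-refl; reachable-trans; reachable?)

  private variable
    a c x y : V D

  Ancestors : V D → Subset (n D)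
  Ancestors a = tabulate (λ x → does (reachable? x a))

  ancestor⁺ : Reachable D x a → x ∈ˢ Ancestors a
  ancestor⁺ {x} {a} x↝a =
    lookup⇒[]= x (Ancestors a) (trans (lookup∘tabulate _ x) (dec-true (reachable? x a) x↝a))

  ancestor⁻ : x ∈ˢ Ancestors a → Reachable D x a
  ancestor⁻ {x} {a} x∈ with reachable? x a | trans (sym (lookup∘tabulate _ x)) ([]=⇒lookup x∈)
  ... | yes x↝a | _ = x↝a

  Source : V D → Set
  Source s = ∀ b → Reachable D b s → Reachable D s b

  -- Stepping to an ancestor that a does not reach strictly shrinks the set of ancestors.
  source-ancestor : ∀ a → ∃ λ s → Reachable D s a × Source s
  source-ancestor a = go a (⊂-wellFounded (Ancestors a))
    where
    go : ∀ a → Acc _⊂_ (Ancestors a) → ∃ λ s → Reachable D s a × Source s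
    go a (acc smaller) with any? (λ b → reachable? b a ×-dec ¬? (reachable? a b))
    ... | yes (b , b↝a , a↝̸b) =
      let (s , s↝b , source) = go b (smaller fewer) in s , reachable-trans s↝b b↝a , source
      where
      fewer : Ancestors b ⊂ Ancestors a
      fewer = (λ x∈ → ancestor⁺ (reachable-trans (ancestor⁻ x∈) b↝a))
            , a , ancestor⁺ reachable-refl , λ a∈ → a↝̸b (ancestor⁻ a∈)
    ... | no ∄ = a , reachable-refl , λ b b↝a →
      decidable-stable (reachable? a b) (λ a↝̸b → ∄ (b , b↝a , a↝̸b))

  component-of-source : Source a → IsInitialStrongComponent D (λ x → Reachable D a x × Reachable D x a)
  component-of-source source =
    ( (_ , reachable-refl , reachable-refl)
    , (λ x y (_ , x↝a) (a↝y , _) → reachable-trans x↝a a↝y)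
    , (λ x y (a↝x , x↝a) x↝y y↝x → reachable-trans a↝x x↝y , reachable-trans y↝x x↝a) )
    , λ x y x→y (_ , y↝a) → let x↝a = reachable-trans (reachable (x→y ∷ [])) y↝a in source x x↝a , x↝a

  reachable-from-unique-initial : ∀ {C} → IsUniqueInitialStrongComponent D C → C c →
                                  ∀ y → Reachable D c y
  reachable-from-unique-initial (((_ , strong , _) , _) , unique) c∈C y =
    let (s , s↝y , source) = source-ancestor y
        s∈C = proj₁ (unique _ (component-of-source source) s) (reachable-refl , reachable-refl)
    in reachable-trans (strong _ s c∈C s∈C) s↝y

KingTriple : ℕ → (D : Digraph) → (V D → Set) → Set
KingTriple k D C = Σ (V D) (λ u₁ → Σ (V D) (λ u₂ → Σ (V D) (λ u₃ →
  C u₁ × C u₂ × C u₃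
  × IsKing D (k + 1) u₁
  × IsKing D (k + 2) u₂
  × Arc D u₂ u₁
  × DistEq D u₂ u₃ (k + 2)
  × IsKing D 4 u₃
  × (∀ w → DistEq D u₂ w (k + 2) → IsKing D 4 w))))

module UniqueInitialComponent (D : Digraph) (q H : ℕ) (q≡2H : q ≡ 2 * H)
                              (qt : KQuasiTransitive (3 + q) D) {C : V D → Set} (unique : IsUniqueInitialStrongComponent D C) where
  open Walks D
  open InitialComponents D using (reachable-from-unique-initial)

  k : ℕ
  k = 3 + q

  private
    strong : ∀ x y → C x → C y → Reachable D x y
    strong = proj₁ (proj₂ (proj₁ (proj₁ unique)))

    closed : ∀ x y → C x → Reachable D x y → Reachable D y x → C y
    closed = proj₂ (proj₂ (proj₁ (proj₁ unique)))

  some-king : ∃ λ c → C c × IsKing D (n D) c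
  some-king =
    let (c , c∈C) = proj₁ (proj₁ (proj₁ unique))
    in c , c∈C , λ y → let (m , p) = reachable-from-unique-initial unique c∈C y
                       in m , <⇒≤ (injective⇒≤ (Path.distinct p)) , p

  king-descent : ∀ E {u} → C u → IsKing D E u → ∃ λ u′ → C u′ × IsKing D (k + 1) u′
  king-descent zero    u∈C king = _ , u∈C , king-mono z≤n king
  king-descent (suc E) {u} u∈C king with suc E ≤? k + 1 | king? E u
  ... | yes E≤k+1 | _          = u , u∈C , king-mono E≤k+1 king
  ... | no  _     | yes king′  = king-descent E u∈C king′
  ... | no  E≰k+1 | no  ¬king′ = king-descent E y∈C y-king
    where
    far-y = ¬∀⟶∃¬ (n D) _ (λ y → distLe? u y E) ¬king′
    y = proj₁ far-y
    dy : Dist u y (suc E)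
    dy = dist-exact (king y) (proj₂ far-y)
    y-king : IsKing D E y
    y-king = Rooted.far-king D q qt u dy (subst (_≤ suc E) (cong suc (+-comm k 1)) (≰⇒> E≰k+1)) king
    y∈C = closed u y u∈C (reachable (proj₁ dy)) (king-reachable y-king u)

  crossing-triple : ∀ {a b} → C a → C b → Arc D a b → ¬ IsKing D (k + 1) a → IsKing D (k + 1) b →
                    KingTriple k D C
  crossing-triple {a} {b} a∈C b∈C a→b ¬king-a king-b =
    b , a , y , b∈C , a∈C , y∈C , king-b , king-a , a→b ,
    dist⇒distEq dy , four-king y (dist⇒distEq dy) , four-king
    where
    k+2≡ : suc (k + 1) ≡ k + 2
    k+2≡ = sym (+-suc k 1)
    king-a⁺ : IsKing D (suc (k + 1)) a
    king-a⁺ z = let (m , m≤k+1 , p) = king-b z in distLe (a→b ∷ fromPath p) (s≤s m≤k+1)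
    king-a : IsKing D (k + 2) a
    king-a = subst (λ r → IsKing D r a) k+2≡ king-a⁺
    far-y = ¬∀⟶∃¬ (n D) _ (λ y → distLe? a y (k + 1)) ¬king-a
    y = proj₁ far-y
    dy : Dist a y (k + 2)
    dy = subst (Dist a y) k+2≡ (dist-exact (king-a⁺ y) (proj₂ far-y))
    four-king : ∀ w → DistEq D a w (k + 2) → IsKing D 4 w
    four-king w dw =
      Rooted.distance-k+2⇒4-king D q qt a (subst (Dist a w) (+-comm k 2) (distEq⇒dist dw)) {H} q≡2H
        (subst (λ r → IsKing D r a) (+-comm k 2) king-a)
    y∈C = closed a y a∈C (reachable (proj₁ dy)) (king-reachable (four-king y (dist⇒distEq dy)) a)

  theorem : (∀ v → C v → IsKing D (k + 1) v) ⊎ KingTriple k D C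
  theorem with some-king
  ... | c , c∈C , c-king with king-descent (n D) c∈C c-king
  ... | u₁ , u₁∈C , u₁-king
    with any? (λ v → (reachable? u₁ v ×-dec reachable? v u₁) ×-dec ¬? (king? (k + 1) v))
  ... | no ∄ = inj₁ λ v v∈C → decidable-stable (king? (k + 1) v)
                 (λ ¬king → ∄ (v , (strong u₁ v u₁∈C v∈C , strong v u₁ v∈C u₁∈C) , ¬king))
  ... | yes (v , (u₁↝v , v↝u₁) , ¬king-v) =
    let (a , b , a→b , ¬king-a , king-b , v↝a , b↝u₁) =
          crossing (king? (k + 1)) (fromPath (proj₂ v↝u₁)) ¬king-v u₁-king
        u₁↝a = reachable-trans u₁↝v v↝a
        a∈C = closed u₁ a u₁∈C u₁↝a (reachable-trans (reachable (a→b ∷ [])) b↝u₁)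
        b∈C = closed u₁ b u₁∈C (reachable-trans u₁↝a (reachable (a→b ∷ []))) b↝u₁
    in inj₂ (crossing-triple a∈C b∈C a→b ¬king-a king-b)

odd≥3 : ∀ {k} → 3 ≤ k → Odd k → ∃ λ H → k ≡ 3 + 2 * H
odd≥3 (s≤s (s≤s (s≤s _))) (suc H , k≡) = H , trans k≡ (solve (H ∷ []))

mainTheorem13 : (k : ℕ) → 3 ≤ k → Odd k → (D : Digraph) → KQuasiTransitive k D
    → (C : V D → Set) → IsUniqueInitialStrongComponent D C
    → (∀ v → C v → IsKing D (k + 1) v)
      ⊎ Σ (V D) (λ u₁ → Σ (V D) (λ u₂ → Σ (V D) (λ u₃ →
          C u₁ × C u₂ × C u₃
          × IsKing D (k + 1) u₁
          × IsKing D (k + 2) u₂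
          × Arc D u₂ u₁
          × DistEq D u₂ u₃ (k + 2)
          × IsKing D 4 u₃
          × (∀ w → DistEq D u₂ w (k + 2) → IsKing D 4 w))))
mainTheorem13 k 3≤k odd D qt C unique with odd≥3 3≤k odd
... | H , refl = UniqueInitialComponent.theorem D (2 * H) H refl qt {C} unique
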